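{- Let $\mathcal{M}=\langle W,\leq,V\rangle$ be an $\mathbf{S}^-_\bot$-model and let $\mathcal{M}'=\langle W',\leq',V'\rangle$ be defined by $W'=W\cup\{g\}$ for a new element $g\notin W$, $\leq'=\leq\cup\{(g,w):w\in W'\}$, and $V'(w,p)=1$ iff $V(w,p)=1$ or ($w=g$ and $V(w',p)=1$ for all $w'\in W$). Let $I$ and $I'$ be the interpretations in $\mathcal{M}$ and $\mathcal{M}'$. Then for every disjunction-free formula $A\in\mathsf{Form}_{\bot,\supset}$: (i) $I(w,A)=1$ iff $I'(w,A)=1$ for every $w\in W$; and (ii) $I(w,A)=1$ for all $w\in W$ iff $I'(g,A)=1$.
   Context: $\mathsf{Form}_{\bot,\supset}$: formulas built from a countable set $\mathsf{Prop}$ of propositional variables and the constant $\bot$ using binary connectives $\land,\lor,\to,\supset$; disjunction-free means $\lor$ does not occur. An $\mathbf{S}^-_\bot$-model is $\langle W,\leq,V\rangle$: $W$ a nonempty set, $\leq$ reflexive and transitive on $W$, $V:W\times\mathsf{Prop}\to\{0,1\}$ with $V(w_1,p)=1$ and $w_1\leq w_2$ implying $V(w_2,p)=1$; interpretation: $I(w,p)=V(w,p)$; $I(w,\bot)=0$; $I(w,A\land B)=1$ iff both are 1; $I(w,A\lor B)=1$ iff at least one is 1; $I(w,A\to B)=1$ iff for all $x\geq w$, $I(x,A)=1$ implies $I(x,B)=1$; $I(w,A\supset B)=1$ iff $I(x,A)\neq1$ for some $x\in W$, or $I(w,B)=1$. ($\mathcal{M}'$ is again an $\mathbf{S}^-_\bot$-model.)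 -}

module Defs where

open import Data.Nat using (ℕ)
open import Data.Maybe using (Maybe; just; nothing)
open import Data.Product using (Σ; _×_; _,_)
open import Data.Sum using (_⊎_)
open import Data.Empty using (⊥)
open import Data.Unit using (⊤)
open import Relation.Nullary using (¬_)
open import Relation.Binary.PropositionalEquality using (_≡_)

Prop : Set
Prop = ℕ

data Form : Set where
  var  : Prop → Form
  bot  : Form
  _∧_  : Form → Form → Form
  _∨_  : Form → Form → Form
  _⇒_  : Form → Form → Form   -- intuitionistic implication →
  _⊃_  : Form → Form → Form

data DisjFree : Form → Set where
  var  : ∀ p → DisjFree (var p)
  bot  : DisjFree bot
  _∧_  : ∀ {A B} → DisjFree A → DisjFree B → DisjFree (A ∧ B)
  _⇒_  : ∀ {A B} → DisjFree A → DisjFree B → DisjFree (A ⇒ B)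
  _⊃_  : ∀ {A B} → DisjFree A → DisjFree B → DisjFree (A ⊃ B)

record Model : Set₁ where
  field
    W      : Set
    _≤_    : W → W → Set
    inhab  : W
    refl≤  : ∀ w → w ≤ w
    trans≤ : ∀ {u v w} → u ≤ v → v ≤ w → u ≤ w
    V      : W → Prop → Set
    mono   : ∀ {w₁ w₂} p → V w₁ p → w₁ ≤ w₂ → V w₂ p

module _ (M : Model) where
  open Model M
  Sat : W → Form → Set
  Sat w (var p) = V w p
  Sat w bot     = ⊥
  Sat w (A ∧ B) = Sat w A × Sat w B
  Sat w (A ∨ B) = Sat w A ⊎ Sat w B
  Sat w (A ⇒ B) = ∀ x → w ≤ x → Sat x A → Sat x B
  Sat w (A ⊃ B) = (Σ W λ x → ¬ Sat x A) ⊎ Sat w B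

-- The extended model M': W' = W ∪ {g}, with g represented by nothing.
module Ext (M : Model) where
  open Model M

  g : Maybe W
  g = nothing

  _≤'_ : Maybe W → Maybe W → Set
  just u  ≤' just v = u ≤ v
  just u  ≤' nothing = ⊥
  nothing ≤' _      = ⊤

  V' : Maybe W → Prop → Set
  V' (just w) p = V w p
  V' nothing  p = ∀ w' → V w' p     -- V(g,p) is never 1 since g ∉ W

  refl≤' : ∀ w → w ≤' w
  refl≤' (just w) = refl≤ w
  refl≤' nothing  = _

  trans≤' : ∀ {u v w} → u ≤' v → v ≤' w → u ≤' w
  trans≤' {nothing} _ _ = _
  trans≤' {just u} {just v} {just w} a b = trans≤ a b
  trans≤' {just u} {just v} {nothing} a ()

  mono' : ∀ {w₁ w₂} p → V' w₁ p → w₁ ≤' w₂ → V' w₂ p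
  mono' {just a} {just b} p v le = mono p v le
  mono' {nothing} {just b} p v _ = v b
  mono' {nothing} {nothing} p v _ = v

  M' : Model
  M' = record
    { W = Maybe W ; _≤_ = _≤'_ ; inhab = nothing
    ; refl≤ = refl≤' ; trans≤ = λ {u} {v} {w} → trans≤' {u} {v} {w}
    ; V = V' ; mono = λ {w₁} {w₂} → mono' {w₁} {w₂} }

-- The new root g lies below every world, so satisfaction at g behaves like validity in M:
-- an implication holds at g iff it holds at every world of M, and a variable holds at g
-- iff it holds everywhere in M by the choice of V'. Disjunction must be
-- excluded because validity of A ∨ B does not give validity of A or of B. The clause for ⊃
-- quantifies over all worlds; a counterexample to A at g is turned into one in W by (ii)
-- for A and excluded middle.
module Submission where

open import Defs
open import Level using (0ℓ)
open import Axiom.ExcludedMiddle using (ExcludedMiddle)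
open import Axiom.DoubleNegationElimination using (DoubleNegationElimination; em⇒dne)
open import Data.Maybe using (just; nothing)
open import Data.Product using (_×_; _,_; ∃; proj₁; proj₂)
open import Data.Sum using (_⊎_; inj₁; inj₂; [_,_]′)
open import Data.Unit using (tt)
open import Function.Base using (id; _∘_)
open import Function.Bundles using (_⇔_; mk⇔; Equivalence)
open import Relation.Nullary using (¬_; yes; no; contradiction)

open Equivalence

¬∀⇒∃¬ : DoubleNegationElimination 0ℓ → {X : Set} {P : X → Set} →
  ¬ (∀ x → P x) → ∃ λ x → ¬ P x
¬∀⇒∃¬ dne ¬∀ = dne λ ¬∃ → ¬∀ λ x → dne λ ¬Px → ¬∃ (x , ¬Px)

∀⊎⇒⊎∀ : ExcludedMiddle 0ℓ → {X P : Set} {Q : X → Set} →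
  (∀ x → P ⊎ Q x) → P ⊎ (∀ x → Q x)
∀⊎⇒⊎∀ em {P = P} h with em {P}
... | yes p = inj₁ p
... | no ¬p = inj₂ λ x → [ (λ p → contradiction p ¬p) , id ]′ (h x)

Refutable : Model → Form → Set
Refutable N A = ∃ λ x → ¬ Sat N x A

module _ (M : Model) where
  open Model M
  open Ext M using (M')

  Valid : Form → Set
  Valid A = ∀ w → Sat M w A

  record Conservative (A : Form) : Set where
    field
      at-W : ∀ w → Sat M w A ⇔ Sat M' (just w) A
      at-g : Valid A ⇔ Sat M' nothing A

  open Conservative

  var-conservative : ∀ p → Conservative (var p)
  var-conservative p = record { at-W = λ _ → mk⇔ id id ; at-g = mk⇔ id id }

  bot-conservative : Conservative bot
  bot-conservative = record { at-W = λ _ → mk⇔ id id ; at-g = mk⇔ (λ v → v inhab) λ () }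

  ∧-conservative : ∀ {A B} → Conservative A → Conservative B → Conservative (A ∧ B)
  ∧-conservative cA cB = record
    { at-W = λ w → mk⇔ (λ (a , b) → to (at-W cA w) a , to (at-W cB w) b)
                       (λ (a , b) → from (at-W cA w) a , from (at-W cB w) b)
    ; at-g = mk⇔ (λ v → to (at-g cA) (proj₁ ∘ v) , to (at-g cB) (proj₂ ∘ v))
                 (λ (a , b) w → from (at-g cA) a w , from (at-g cB) b w)
    }

  ⇒-conservative : ∀ {A B} → Conservative A → Conservative B → Conservative (A ⇒ B)
  ⇒-conservative {A} {B} cA cB = record
    { at-W = λ w → mk⇔ (to-W w) (from-W w) ; at-g = mk⇔ to-g from-g }
    where
    to-W : ∀ w → Sat M w (A ⇒ B) → Sat M' (just w) (A ⇒ B)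
    to-W w h (just x) w≤x a = to (at-W cB x) (h x w≤x (from (at-W cA x) a))

    from-W : ∀ w → Sat M' (just w) (A ⇒ B) → Sat M w (A ⇒ B)
    from-W w h x w≤x a = from (at-W cB x) (h (just x) w≤x (to (at-W cA x) a))

    to-g : Valid (A ⇒ B) → Sat M' nothing (A ⇒ B)
    to-g v (just x) _ a = to (at-W cB x) (v x x (refl≤ x) (from (at-W cA x) a))
    to-g v nothing  _ a = to (at-g cB) λ w → v w w (refl≤ w) (from (at-g cA) a w)

    from-g : Sat M' nothing (A ⇒ B) → Valid (A ⇒ B)
    from-g h w x _ a = from (at-W cB x) (h (just x) tt (to (at-W cA x) a))

  refutable-conservative : ExcludedMiddle 0ℓ → ∀ {A} → Conservative A →
    Refutable M A ⇔ Refutable M' A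
  refutable-conservative em {A} cA = mk⇔ to-M' from-M'
    where
    to-M' : Refutable M A → Refutable M' A
    to-M' (x , ¬a) = just x , λ a → ¬a (from (at-W cA x) a)

    from-M' : Refutable M' A → Refutable M A
    from-M' (just x  , ¬a) = x , λ a → ¬a (to (at-W cA x) a)
    from-M' (nothing , ¬a) = ¬∀⇒∃¬ (em⇒dne em) λ v → ¬a (to (at-g cA) v)

  ⊃-conservative : ExcludedMiddle 0ℓ → ∀ {A B} → Conservative A → Conservative B →
    Conservative (A ⊃ B)
  ⊃-conservative em {A} cA cB = record
    { at-W = λ w → mk⇔ [ inj₁ ∘ to refuteA , inj₂ ∘ to (at-W cB w) ]′
                       [ inj₁ ∘ from refuteA , inj₂ ∘ from (at-W cB w) ]′
    ; at-g = mk⇔ (λ v → [ inj₁ ∘ to refuteA , inj₂ ∘ to (at-g cB) ]′ (∀⊎⇒⊎∀ em v))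
                 [ (λ r _ → inj₁ (from refuteA r)) , (λ b w → inj₂ (from (at-g cB) b w)) ]′
    }
    where
    refuteA : Refutable M A ⇔ Refutable M' A
    refuteA = refutable-conservative em cA

  disjFree-conservative : ExcludedMiddle 0ℓ → ∀ {A} → DisjFree A → Conservative A
  disjFree-conservative em (var p) = var-conservative p
  disjFree-conservative em bot     = bot-conservative
  disjFree-conservative em (dA ∧ dB) =
    ∧-conservative (disjFree-conservative em dA) (disjFree-conservative em dB)
  disjFree-conservative em (dA ⇒ dB) =
    ⇒-conservative (disjFree-conservative em dA) (disjFree-conservative em dB)
  disjFree-conservative em (dA ⊃ dB) =
    ⊃-conservative em (disjFree-conservative em dA) (disjFree-conservative em dB)

mainTheorem13 : ExcludedMiddle 0ℓ → (M : Model) → (A : Form) → DisjFree A →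
    ((w : Model.W M) → Sat M w A ⇔ Sat (Ext.M' M) (just w) A)
    × (((w : Model.W M) → Sat M w A) ⇔ Sat (Ext.M' M) nothing A)
mainTheorem13 em M A dA = at-W , at-g
  where open Conservative (disjFree-conservative M em dA)
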